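{- Let $\Omega$ be a countably infinite set, $E=\mathrm{Self}(\Omega)$, and $M$ a submonoid of $E$. Suppose there exist a sequence $(\alpha_i)_{i\in\omega}$ of distinct elements of $\Omega$ and nonempty subsets $D_i\subseteq\Omega^i$ ($i\in\omega$) such that (i) for each $i\in\omega$ and $(\beta_0,\dots,\beta_{i-1})\in D_i$ there exist infinitely many $\beta\in\Omega$ with $(\beta_0,\dots,\beta_{i-1},\beta)\in D_{i+1}$; and (ii) whenever $(\beta_i)_{i\in\omega}\in\Omega^\omega$ satisfies $(\beta_0,\dots,\beta_{i-1})\in D_i$ for every $i\in\omega$, there exists $g\in M$ with $\beta_i=(\alpha_i)g$ for all $i$, and the elements $\beta_i$ are all distinct. Then there exist $f,h\in E$ with $E=fMh$. In particular $M\approx E$.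
   Context: $\mathrm{Self}(\Omega)$ is the monoid of maps $\Omega\to\Omega$, written on the right of arguments and composed left to right ($fMh=\{fgh:g\in M\}$, where $(\alpha)fgh=(((\alpha)f)g)h$). $\Omega^i$ is the set of $i$-tuples ($\Omega^0$ contains only the empty tuple). $\langle X\rangle$ is the generated submonoid; $M_1\approx M_2$ means there exist finite $U,V\subseteq E$ with $M_1\subseteq\langle M_2\cup U\rangle$ and $M_2\subseteq\langle M_1\cup V\rangle$. -}

module Defs where

open import Data.Nat using (ℕ; suc)
open import Data.Fin using (Fin; toℕ)
open import Data.Vec using (Vec; tabulate; _∷ʳ_)
open import Data.List using (List)
open import Data.List.Relation.Unary.Any using (Any)
open import Data.List.Membership.Propositional using (_∉_)
open import Data.Product using (Σ; _×_; ∃)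
open import Data.Sum using (_⊎_)
open import Function using (_↔_; Injective)
open import Relation.Binary.PropositionalEquality using (_≡_; _≗_)

-- Self(Ω): maps Ω → Ω.  Maps are written on the right and composed left to right:
-- (α) f g = g (f α).  So  f ⨾ g  :=  λ α → g (f α).
_⨾_ : {Ω : Set} → (Ω → Ω) → (Ω → Ω) → (Ω → Ω)
(f ⨾ g) α = g (f α)

CountablyInfinite : Set → Set
CountablyInfinite Ω = Ω ↔ ℕ

-- A subset of Self(Ω) is a predicate; being a submonoid. Since maps are sets of
-- pairs in set theory, a subset is automatically closed under pointwise equality.
record IsSubmonoid {Ω : Set} (M : (Ω → Ω) → Set) : Set where
  field
    ext   : ∀ {f g} → M f → f ≗ g → M g
    one   : M (λ α → α)
    comp  : ∀ {f g} → M f → M g → M (f ⨾ g)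

InfinitelyMany : {Ω : Set} → (Ω → Set) → Set
InfinitelyMany {Ω} P = (xs : List Ω) → Σ Ω λ β → P β × β ∉ xs

prefix : {Ω : Set} → (ℕ → Ω) → (i : ℕ) → Vec Ω i
prefix β i = tabulate λ (j : Fin i) → β (toℕ j)

data Gen {Ω : Set} (X : (Ω → Ω) → Set) : (Ω → Ω) → Set where
  base : ∀ {f} → X f → Gen X f
  one  : Gen X (λ α → α)
  comp : ∀ {f g} → Gen X f → Gen X g → Gen X (f ⨾ g)
  ext  : ∀ {f g} → Gen X f → f ≗ g → Gen X g

_∈E_ : {Ω : Set} → (Ω → Ω) → List (Ω → Ω) → Set
f ∈E U = Any (λ u → u ≗ f) U

_≈M_ : {Ω : Set} → ((Ω → Ω) → Set) → ((Ω → Ω) → Set) → Set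
_≈M_ {Ω} M₁ M₂ = Σ (List (Ω → Ω)) λ U → Σ (List (Ω → Ω)) λ V →
  (∀ g → M₁ g → Gen (λ x → M₂ x ⊎ x ∈E U) g) ×
  (∀ g → M₂ g → Gen (λ x → M₁ x ⊎ x ∈E V) g)

Whole : {Ω : Set} → (Ω → Ω) → Set
Whole _ = Data.Unit.⊤
  where import Data.Unit

-- Let code : Ω ↔ ℕ with inverse ψ. Enumerate the vertices of the tree D as v₀ = root, v₁, v₂, …,
-- where v_{m+1} is a child of v_p for (p , y) = unpair m and carries the label y. The new entry
-- ("tip") of v_{m+1} is chosen with a code larger than that of the tip of v_m, which is possible
-- because every vertex has infinitely many children; so all tips are distinct and one map h sends
-- the tip of each vertex to ψ of its label. Given k, following the labels code((ψ 0)k),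
-- code((ψ 1)k), … from the root traces a branch β with (βᵢ)h = (ψ i)k, and a g ∈ M with
-- βᵢ = (αᵢ)g yields k = f g h for (ω)f = α_(code ω).
-- Since the tips are distinct by construction, neither the submonoid axioms nor the injectivity of
-- α and of the branches is needed.
module Submission where

open import Defs
open import Data.Nat using (ℕ; zero; suc; _+_; _≤_; _<_; _≟_; _≤?_; z≤n; s≤s)
open import Data.Nat.Properties
  using (+-suc; +-identityʳ; m≤m+n; ≤-refl; ≤-trans; ≤-pred; <-trans; <-≤-trans; ≤∧≢⇒<; <⇒≢;
         ≰⇒>; m≤n⇒m≤1+n; <-cmp; ≟-diag)
open import Data.Vec using (Vec; []; _∷_; _∷ʳ_)
open import Data.List using ([]; _∷_; map; upTo)
open import Data.List.Relation.Unary.Any using (here; there)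
open import Data.List.Membership.Propositional using (_∈_)
open import Data.List.Membership.Propositional.Properties using (∈-map⁺; ∈-upTo⁺)
open import Data.Product using (Σ; _×_; _,_; proj₁; proj₂; uncurry)
open import Data.Sum using (inj₁; inj₂)
open import Data.Unit using (tt)
open import Data.Empty using (⊥-elim)
open import Relation.Nullary using (yes; no)
open import Relation.Binary using (tri<; tri≈; tri>)
open import Function using (_∘_; _↔_; Inverse; Injective)
open import Relation.Binary.PropositionalEquality
  using (_≡_; _≗_; refl; sym; trans; cong; cong₂; subst; module ≡-Reasoning)

open ≡-Reasoning

nextPair : ℕ × ℕ → ℕ × ℕ
nextPair (zero  , y) = suc y , zero
nextPair (suc x , y) = x , suc y

unpair : ℕ → ℕ × ℕ
unpair zero    = 0 , 0
unpair (suc m) = nextPair (unpair m)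

triangle : ℕ → ℕ
triangle zero    = zero
triangle (suc s) = suc (triangle s + s)

pair : ℕ → ℕ → ℕ
pair x y = triangle (x + y) + y

unpair-diagonal : ∀ s x y → x + y ≡ s → unpair (triangle s + y) ≡ (x , y)
unpair-diagonal zero    zero zero    refl      = refl
unpair-diagonal (suc s) x    zero    x+0≡1+s   = begin
  unpair (triangle (suc s) + 0)       ≡⟨ cong (nextPair ∘ unpair) (+-identityʳ (triangle s + s)) ⟩
  nextPair (unpair (triangle s + s))  ≡⟨ cong nextPair (unpair-diagonal s 0 s refl) ⟩
  (suc s , 0)                         ≡⟨ cong (_, 0) (trans (sym x+0≡1+s) (+-identityʳ x)) ⟩
  (x , 0)                             ∎
unpair-diagonal s       x    (suc y) x+1+y≡s   = begin
  unpair (triangle s + suc y)         ≡⟨ cong unpair (+-suc (triangle s) y) ⟩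
  nextPair (unpair (triangle s + y))  ≡⟨ cong nextPair (unpair-diagonal s (suc x) y
                                                          (trans (sym (+-suc x y)) x+1+y≡s)) ⟩
  (x , suc y)                         ∎

unpair-pair : ∀ x y → unpair (pair x y) ≡ (x , y)
unpair-pair x y = unpair-diagonal (x + y) x y refl

unpair-sum-≤ : ∀ m → proj₁ (unpair m) + proj₂ (unpair m) ≤ m
unpair-sum-≤ zero = z≤n
unpair-sum-≤ (suc m) with unpair m | unpair-sum-≤ m
... | zero  , y | y≤m   rewrite +-identityʳ y = s≤s y≤m
... | suc x , y | 1+x+y≤m rewrite +-suc x y   = m≤n⇒m≤1+n 1+x+y≤m

proj₁-unpair-≤ : ∀ m → proj₁ (unpair m) ≤ m
proj₁-unpair-≤ m = ≤-trans (m≤m+n _ _) (unpair-sum-≤ m)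

module CourseOfValues {A : Set} (start : A) (step : (ℕ → A) → ℕ → A) where

  Causal : Set
  Causal = ∀ {t t′} m → (∀ {j} → j ≤ m → t j ≡ t′ j) → step t m ≡ step t′ m

  private
    history : ℕ → ℕ → A
    history zero    _ = start
    history (suc m) j with j ≟ suc m
    ... | yes _ = step (history m) m
    ... | no  _ = history m j

  courseOfValues : ℕ → A
  courseOfValues m = history m m

  private
    history-stable : ∀ {m j} → j ≤ m → history m j ≡ courseOfValues j
    history-stable {zero}  z≤n = refl
    history-stable {suc m} {j} j≤1+m with j ≟ suc m
    ... | yes refl rewrite ≟-diag {suc m} refl = refl
    ... | no  j≢1+m = history-stable (≤-pred (≤∧≢⇒< j≤1+m j≢1+m))

    history-new : ∀ m → history (suc m) (suc m) ≡ step (history m) m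
    history-new m rewrite ≟-diag {suc m} refl = refl

  courseOfValues-suc : Causal → ∀ m → courseOfValues (suc m) ≡ step courseOfValues m
  courseOfValues-suc causal m = trans (history-new m) (causal m history-stable)

module StrictlyIncreasing {s : ℕ → ℕ} (s-increasing : ∀ m → s m < s (suc m)) where

  s-mono : ∀ {m n} → m < n → s m < s n
  s-mono {m} {suc n} (s≤s m≤n) with m ≟ n
  ... | yes refl = s-increasing m
  ... | no  m≢n  = <-trans (s-mono (≤∧≢⇒< m≤n m≢n)) (s-increasing n)

  s-injective : Injective _≡_ _≡_ s
  s-injective {m} {n} sm≡sn with <-cmp m n
  ... | tri< m<n _ _ = ⊥-elim (<⇒≢ (s-mono m<n) sm≡sn)
  ... | tri≈ _ m≡n _ = m≡n
  ... | tri> _ _ n<m = ⊥-elim (<⇒≢ (s-mono n<m) (sym sm≡sn))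

  n≤s[n] : ∀ n → n ≤ s n
  n≤s[n] zero    = z≤n
  n≤s[n] (suc n) = <-≤-trans (s≤s (n≤s[n] n)) (s-increasing n)

  -- The largest m ≤ N with s m ≡ x, and 0 if there is none.
  search : ℕ → ℕ → ℕ
  search zero    x = zero
  search (suc N) x with s (suc N) ≟ x
  ... | yes _ = suc N
  ... | no  _ = search N x

  search-s : ∀ {m} N → m ≤ N → search N (s m) ≡ m
  search-s zero z≤n = refl
  search-s {m} (suc N) m≤1+N with s (suc N) ≟ s m
  ... | yes s[1+N]≡sm = s-injective s[1+N]≡sm
  ... | no  s[1+N]≢sm = search-s N (≤-pred (≤∧≢⇒< m≤1+N (s[1+N]≢sm ∘ cong s ∘ sym)))

  preimage : ℕ → ℕ
  preimage x = search x x

  preimage-s : ∀ m → preimage (s m) ≡ m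
  preimage-s m = search-s (s m) (n≤s[n] m)

module _ {Ω : Set} (I : Ω ↔ ℕ) where
  open Inverse I

  infinitelyMany⇒unbounded : {P : Ω → Set} → InfinitelyMany P → ∀ b → Σ Ω λ ω → P ω × b < to ω
  infinitelyMany⇒unbounded infinite b with infinite (map from (upTo (suc b)))
  ... | ω , Pω , ω∉ with to ω ≤? b
  ...   | yes ω≤b = ⊥-elim (ω∉ (subst (_∈ _) (strictlyInverseʳ ω) (∈-map⁺ from (∈-upTo⁺ (s≤s ω≤b)))))
  ...   | no  ω≰b = ω , Pω , ≰⇒> ω≰b

prefix-suc : {Ω : Set} (β : ℕ → Ω) (i : ℕ) → prefix β (suc i) ≡ prefix β i ∷ʳ β i
prefix-suc β zero    = refl
prefix-suc β (suc i) = cong (β 0 ∷_) (prefix-suc (β ∘ suc) i)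

Branch : {Ω : Set} → ((i : ℕ) → Vec Ω i → Set) → (ℕ → Ω) → Set
Branch D β = ∀ i → D i (prefix β i)

module LabelledTree {Ω : Set} (I : Ω ↔ ℕ) (D : (i : ℕ) → Vec Ω i → Set) (root : D 0 [])
  (infinite : ∀ i (b : Vec Ω i) → D i b → InfinitelyMany (λ β → D (suc i) (b ∷ʳ β))) where

  open Inverse I renaming (to to code; from to decode)

  Position : Set
  Position = Σ ℕ (Vec Ω)

  Vertex : Set
  Vertex = Σ Position (uncurry D)

  extend : Position → Ω → Position
  extend (d , v) ω = suc d , v ∷ʳ ω

  freshChild : (x : Vertex) (b : ℕ) → Σ Ω λ ω → uncurry D (extend (proj₁ x) ω) × b < code ω
  freshChild ((d , v) , Dv) = infinitelyMany⇒unbounded I (infinite d v Dv)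

  child : Vertex → ℕ → Vertex × Ω
  child x b = (extend (proj₁ x) ω , proj₁ (proj₂ fresh)) , ω
    where
    fresh : Σ Ω λ ω → uncurry D (extend (proj₁ x) ω) × b < code ω
    fresh = freshChild x b
    ω : Ω
    ω = proj₁ fresh

  parent : ℕ → ℕ
  parent m = proj₁ (unpair m)

  label : ℕ → ℕ
  label zero    = 0
  label (suc m) = proj₂ (unpair m)

  grow : (ℕ → Vertex × Ω) → ℕ → Vertex × Ω
  grow t m = child (proj₁ (t (parent m))) (code (proj₂ (t m)))

  -- The root has no tip; decode 0 is a junk value.
  open CourseOfValues (((0 , []) , root) , decode 0) grow

  entry : ℕ → Vertex × Ω
  entry = courseOfValues

  vertex : ℕ → Vertex
  vertex = proj₁ ∘ entry

  tip : ℕ → Ω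
  tip = proj₂ ∘ entry

  entry-suc : ∀ m → entry (suc m) ≡ grow entry m
  entry-suc = courseOfValues-suc λ m agree →
    cong₂ (λ p t → child (proj₁ p) (code (proj₂ t))) (agree (proj₁-unpair-≤ m)) (agree ≤-refl)

  position-suc : ∀ m → proj₁ (vertex (suc m)) ≡ extend (proj₁ (vertex (parent m))) (tip (suc m))
  position-suc m rewrite entry-suc m = refl

  tip-increasing : ∀ m → code (tip m) < code (tip (suc m))
  tip-increasing m rewrite entry-suc m = proj₂ (proj₂ (freshChild (vertex (parent m)) (code (tip m))))

  open StrictlyIncreasing tip-increasing using (preimage; preimage-s)

  labelOf : Ω → ℕ
  labelOf ω = label (preimage (code ω))

  labelOf-tip : ∀ m → labelOf (tip m) ≡ label m
  labelOf-tip m = cong label (preimage-s m)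

  module Following (n : ℕ → ℕ) where

    index : ℕ → ℕ
    index zero    = 0
    index (suc i) = suc (pair (index i) (n i))

    branch : ℕ → Ω
    branch i = tip (index (suc i))

    position-branch : ∀ i → proj₁ (vertex (index i)) ≡ (i , prefix branch i)
    position-branch zero    = refl
    position-branch (suc i) = begin
      proj₁ (vertex (index (suc i)))
        ≡⟨ position-suc (pair (index i) (n i)) ⟩
      extend (proj₁ (vertex (parent (pair (index i) (n i))))) (branch i)
        ≡⟨ cong (λ p → extend (proj₁ (vertex (proj₁ p))) (branch i)) (unpair-pair (index i) (n i)) ⟩
      extend (proj₁ (vertex (index i))) (branch i)
        ≡⟨ cong (λ p → extend p (branch i)) (position-branch i) ⟩
      (suc i , prefix branch i ∷ʳ branch i)
        ≡⟨ cong (suc i ,_) (prefix-suc branch i) ⟨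
      (suc i , prefix branch (suc i))
        ∎

    branch-isBranch : Branch D branch
    branch-isBranch i = subst (uncurry D) (position-branch i) (proj₂ (vertex (index i)))

    labelOf-branch : ∀ i → labelOf (branch i) ≡ n i
    labelOf-branch i = trans (labelOf-tip (index (suc i))) (cong proj₂ (unpair-pair (index i) (n i)))

branches-cover-sequences : {Ω : Set} → Ω ↔ ℕ → (D : (i : ℕ) → Vec Ω i → Set) → D 0 [] →
  (∀ i (b : Vec Ω i) → D i b → InfinitelyMany (λ β → D (suc i) (b ∷ʳ β))) →
  Σ (Ω → Ω) λ h → ∀ (κ : ℕ → Ω) → Σ (ℕ → Ω) λ β → Branch D β × (∀ i → h (β i) ≡ κ i)
branches-cover-sequences I D root infinite = decode ∘ labelOf , λ κ →
  let open Following (code ∘ κ) in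
  branch , branch-isBranch , λ i → trans (cong decode (labelOf-branch i)) (strictlyInverseʳ (κ i))
  where
  open Inverse I renaming (to to code; from to decode)
  open LabelledTree I D root infinite

Factorises : {Ω : Set} → ((Ω → Ω) → Set) → (Ω → Ω) → (Ω → Ω) → Set
Factorises {Ω} M f h = ∀ (k : Ω → Ω) → Σ (Ω → Ω) λ g → M g × k ≗ ((f ⨾ g) ⨾ h)

factorises⇒≈Whole : {Ω : Set} {M : (Ω → Ω) → Set} {f h : Ω → Ω} → Factorises M f h → M ≈M Whole
factorises⇒≈Whole {f = f} {h} factorises =
  [] , f ∷ h ∷ [] , (λ _ _ → base (inj₁ tt)) , λ k _ →
    let (g , Mg , k≗fgh) = factorises k in
    ext (comp (comp (base (inj₂ (here λ _ → refl))) (base (inj₁ Mg)))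
              (base (inj₂ (there (here λ _ → refl)))))
        (sym ∘ k≗fgh)

lemma18 : (Ω : Set) → CountablyInfinite Ω →
    (M : (Ω → Ω) → Set) → IsSubmonoid M →
    (α : ℕ → Ω) → Injective _≡_ _≡_ α →
    (D : (i : ℕ) → Vec Ω i → Set) →
    (∀ i → Σ (Vec Ω i) (D i)) →
    (∀ i (b : Vec Ω i) → D i b → InfinitelyMany (λ β → D (suc i) (b ∷ʳ β))) →
    (∀ (β : ℕ → Ω) → (∀ i → D i (prefix β i)) →
       Σ (Ω → Ω) (λ g → M g × (∀ i → β i ≡ g (α i))) × Injective _≡_ _≡_ β) →
    Σ (Ω → Ω) (λ f → Σ (Ω → Ω) (λ h →
      ∀ (k : Ω → Ω) → Σ (Ω → Ω) (λ g → M g × k ≗ ((f ⨾ g) ⨾ h))))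
    × (M ≈M Whole)
lemma18 Ω I M _ α _ D nonempty infinite realise =
  (f , h , factorises) , factorises⇒≈Whole {M = M} {f} {h} factorises
  where
  open Inverse I renaming (to to code; from to decode)

  root : D 0 []
  root with nonempty 0
  ... | [] , D[] = D[]

  cover : Σ (Ω → Ω) λ h → ∀ (κ : ℕ → Ω) → Σ (ℕ → Ω) λ β → Branch D β × (∀ i → h (β i) ≡ κ i)
  cover = branches-cover-sequences I D root infinite

  h : Ω → Ω
  h = proj₁ cover

  f : Ω → Ω
  f = α ∘ code

  factorises : Factorises M f h
  factorises k =
    let (β , β-branch , hβ≡) = proj₂ cover (k ∘ decode)
        ((g , Mg , β≡αg) , _) = realise β β-branch
    in g , Mg , λ ω → begin
      k ω                    ≡⟨ cong k (strictlyInverseʳ ω) ⟨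
      k (decode (code ω))    ≡⟨ hβ≡ (code ω) ⟨
      h (β (code ω))         ≡⟨ cong h (β≡αg (code ω)) ⟩
      h (g (α (code ω)))     ∎
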